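{- Let $H$ be a skew Hadamard matrix of order $n$. Then the number of $4\times4$ principal submatrices of $H$ (one for each $4$-element set of indices) that are SH-equivalent to $A=\begin{pmatrix}1&1&1&1\\-1&1&1&1\\-1&-1&1&1\\-1&-1&-1&1\end{pmatrix}$ is $n(n-1)(n-2)(n-4)/32$.
   Context: A Hadamard matrix of order $n$ is an $n\times n$ matrix $H$ with entries in $\{ -1,1\}$ and $HH^\top=nI$; it is skew Hadamard if moreover $H+H^\top=2I$. A signed permutation matrix is a matrix with entries in $\{ -1,0,1\}$ having exactly one nonzero entry in each row and each column. Two matrices $X,Y$ with entries in $\{ -1,1\}$ are SH-equivalent if $Y=P^\top XP$ for some signed permutation matrix $P$. -}

module Defs where

open import Data.Nat using (ℕ; zero; suc)
open import Data.Integer using (ℤ; +_; -[1+_]; _+_; _*_; 0ℤ; 1ℤ; -1ℤ)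
open import Data.Fin using (Fin; _<_)
open import Data.Fin.Patterns using (0F; 1F; 2F; 3F)
open import Data.Product using (Σ; _×_; _,_; ∃)
open import Data.Sum using (_⊎_)
open import Relation.Binary.PropositionalEquality using (_≡_; _≢_)
open import Relation.Nullary using (¬_)

Mat : ℕ → Set
Mat n = Fin n → Fin n → ℤ

sumℤ : ∀ {n} → (Fin n → ℤ) → ℤ
sumℤ {zero}  f = 0ℤ
sumℤ {suc n} f = f Fin.zero + sumℤ (λ k → f (Fin.suc k))

_ᵀ : ∀ {n} → Mat n → Mat n
(M ᵀ) i j = M j i

_⊗_ : ∀ {n} → Mat n → Mat n → Mat n
(M ⊗ N) i j = sumℤ (λ k → M i k * N k j)

_⊕_ : ∀ {n} → Mat n → Mat n → Mat n
(M ⊕ N) i j = M i j + N i j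

scalarI : ∀ {n} → ℤ → Mat n
scalarI {n} c i j with i Data.Fin.≟ j
... | Relation.Nullary.yes _ = c
... | Relation.Nullary.no  _ = 0ℤ

IsPM1 : ℤ → Set
IsPM1 x = (x ≡ 1ℤ) ⊎ (x ≡ -1ℤ)

PM1Matrix : ∀ {n} → Mat n → Set
PM1Matrix M = ∀ i j → IsPM1 (M i j)

IsHadamard : ∀ n → Mat n → Set
IsHadamard n H = PM1Matrix H × (∀ i j → (H ⊗ (H ᵀ)) i j ≡ scalarI (+ n) i j)

IsSkewHadamard : ∀ n → Mat n → Set
IsSkewHadamard n H = IsHadamard n H × (∀ i j → (H ⊕ (H ᵀ)) i j ≡ scalarI (+ 2) i j)

IsSignedPerm : ∀ {n} → Mat n → Set
IsSignedPerm {n} P =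
  (∀ i j → (P i j ≡ 0ℤ) ⊎ IsPM1 (P i j)) ×
  (∀ i → Σ (Fin n) λ j → (P i j ≢ 0ℤ) × (∀ j' → P i j' ≢ 0ℤ → j' ≡ j)) ×
  (∀ j → Σ (Fin n) λ i → (P i j ≢ 0ℤ) × (∀ i' → P i' j ≢ 0ℤ → i' ≡ i))

SHEquiv : ∀ {n} → Mat n → Mat n → Set
SHEquiv {n} X Y = Σ (Mat n) λ P → IsSignedPerm P × (∀ i j → Y i j ≡ ((P ᵀ) ⊗ (X ⊗ P)) i j)

A : Mat 4
A i j with i Data.Fin.<? j | i Data.Fin.≟ j
... | Relation.Nullary.yes _ | _ = 1ℤ
... | Relation.Nullary.no _  | Relation.Nullary.yes _ = 1ℤ
... | Relation.Nullary.no _  | Relation.Nullary.no _ = -1ℤ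

-- a 4-element set of indices {i<j<k<l}, as an increasing quadruple
Quad : ℕ → Set
Quad n = Fin n × Fin n × Fin n × Fin n

IncreasingQuad : ∀ {n} → Quad n → Set
IncreasingQuad (i , j , k , l) = (i < j) × (j < k) × (k < l)

principal4 : ∀ {n} → Mat n → Quad n → Mat 4
principal4 H (i , j , k , l) a b = H (pick a) (pick b)
  where
  pick : Fin 4 → _
  pick 0F = i
  pick 1F = j
  pick 2F = k
  pick 3F = l

-- Write H = I + S with S skew-symmetric and ±1 off the diagonal, and attach to a matrix the signed count of 4-cycles
-- cycleSum = Σ_{a,b,c,d} S_ab S_bc S_cd S_da S_ac² S_bd². It is invariant under SH-equivalence (signs enter squared,
-- a permutation only reindexes the sum), and grouping its terms by their index set shows that cycleSum H is the sum of
-- cycleSum H_q over the 4-subsets q. A 4×4 skew matrix normalises to a tournament in which vertex 0 beats the others;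
-- its cycleSum is 8 when the tournament is transitive, i.e. the matrix is SH-equivalent to A, and -24 when it is
-- cyclic. Orthogonality of the rows of S gives cycleSum H = -n(n-1)(n-2), hence
-- 32 · #{q : H_q ∼ A} = Σ_q (cycleSum H_q + 24) = -n(n-1)(n-2) + n(n-1)(n-2)(n-3) = n(n-1)(n-2)(n-4).
module Submission where

open import Defs
open import Data.Nat using (ℕ)
open import Data.Integer using (ℤ; +_; _*_; _-_)
open import Data.List using (List; length)
open import Data.List.Membership.Propositional using (_∈_)
open import Data.List.Relation.Unary.Unique.Propositional using (Unique)
open import Data.Product using (Σ; _×_)
open import Function.Bundles using (_⇔_)
open import Relation.Binary.PropositionalEquality using (_≡_)

open import Data.Nat as ℕ using (zero; suc; s≤s; z≤n)
import Data.Nat.Properties as ℕP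
open import Data.Integer as ℤ using (-[1+_]; _+_; -_; 0ℤ; 1ℤ; -1ℤ)
import Data.Integer.Properties as ℤP
open import Data.Integer.Tactic.RingSolver using (solve-∀)
open import Data.Fin as Fin using (Fin; zero; suc)
import Data.Fin.Properties as FinP
open import Data.Fin.Patterns using (0F; 1F; 2F; 3F)
open import Data.Fin.Permutation as Perm using (Permutation′; _⟨$⟩ʳ_; _⟨$⟩ˡ_; _∘ₚ_; permutation; transpose)
open import Data.Bool using (true; false; if_then_else_)
open import Data.Unit using (⊤; tt)
open import Data.Product using (_,_; proj₁; proj₂)
open import Data.Sum using (_⊎_; inj₁; inj₂; map₂; [_,_]′)
open import Data.List using ([]; _∷_; map; _++_; filter; foldr; tabulate; allFin)
import Data.List.Properties as ListP
open import Data.List.Membership.Propositional.Properties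
  using (∈-map⁺; ∈-map⁻; ∈-++⁺ˡ; ∈-++⁺ʳ; ∈-++⁻; ∈-allFin; ∈-filter⁺; ∈-filter⁻)
import Data.List.Relation.Unary.Unique.Propositional.Properties as UniqueP
open import Function using (_∘_)
open import Function.Bundles using (Injection; mk⇔; Equivalence)
open import Function.Properties.Inverse using (↔⇒↣)
open import Relation.Nullary using (¬_; Dec; does; yes; no; contradiction)
open import Relation.Nullary.Decidable using (True; toWitness)
open import Relation.Unary using (Pred; Decidable)
open import Relation.Binary.PropositionalEquality using (_≢_; refl; sym; trans; cong; cong₂; subst; module ≡-Reasoning)
open import Algebra.Properties.Semiring.Sum ℤP.+-*-semiring
  using (sum; sum-cong-≗; ∑-distrib-+; ∑-comm; sum-permute; *-distribˡ-sum)

-- Finite sums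

sumℤ≡sum : ∀ {n} (f : Fin n → ℤ) → sumℤ f ≡ sum f
sumℤ≡sum {zero}  f = refl
sumℤ≡sum {suc n} f = cong (λ s → f zero + s) (sumℤ≡sum (λ k → f (suc k)))

sum-const : ∀ n (c : ℤ) → sum {n} (λ _ → c) ≡ + n * c
sum-const zero    c = refl
sum-const (suc n) c = trans (cong (λ s → c + s) (sum-const n c)) (sym (ℤP.suc-* (+ n) c))

sum-neg : ∀ {n} (f : Fin n → ℤ) → sum (λ i → - f i) ≡ - sum f
sum-neg {zero}  f = refl
sum-neg {suc n} f =
  trans (cong (λ s → - f zero + s) (sum-neg (λ i → f (suc i)))) (sym (ℤP.neg-distrib-+ (f zero) _))

sum-zero : ∀ {n} {f : Fin n → ℤ} → (∀ i → f i ≡ 0ℤ) → sum f ≡ 0ℤ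
sum-zero {n} f≗0 = trans (sum-cong-≗ f≗0) (trans (sum-const n 0ℤ) (ℤP.*-zeroʳ (+ n)))

sum-single : ∀ {n} (f : Fin n → ℤ) (k : Fin n) → (∀ l → l ≢ k → f l ≡ 0ℤ) → sum f ≡ f k
sum-single {suc n} f zero    f≡0 =
  trans (cong (λ s → f zero + s) (sum-zero (λ l → f≡0 (suc l) λ ()))) (ℤP.+-identityʳ (f zero))
sum-single {suc n} f (suc k) f≡0 = trans
  (cong₂ _+_ (f≡0 zero λ ()) (sum-single (f ∘ suc) k (λ l l≢k → f≡0 (suc l) (l≢k ∘ FinP.suc-injective))))
  (ℤP.+-identityˡ (f (suc k)))

δ : ∀ {n} → Fin n → Fin n → ℤ
δ = scalarI 1ℤ

scalarI-diag : ∀ {n} (c : ℤ) (i : Fin n) → scalarI c i i ≡ c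
scalarI-diag c i with i Fin.≟ i
... | yes _   = refl
... | no i≢i = contradiction refl i≢i

scalarI-off : ∀ {n} (c : ℤ) {i j : Fin n} → i ≢ j → scalarI c i j ≡ 0ℤ
scalarI-off c {i} {j} i≢j with i Fin.≟ j
... | yes i≡j = contradiction i≡j i≢j
... | no _    = refl

δ-sym : ∀ {n} (i j : Fin n) → δ i j ≡ δ j i
δ-sym i j with i Fin.≟ j | j Fin.≟ i
... | yes _   | yes _   = refl
... | no _    | no _    = refl
... | yes i≡j | no j≢i = contradiction (sym i≡j) j≢i
... | no i≢j | yes j≡i = contradiction (sym j≡i) i≢j

sum-δ : ∀ {n} (i : Fin n) (g : Fin n → ℤ) → sum (λ k → δ i k * g k) ≡ g i
sum-δ i g = trans (sum-single _ i (λ k k≢i → cong (_* g k) (scalarI-off 1ℤ (k≢i ∘ sym))))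
                  (trans (cong (_* g i) (scalarI-diag 1ℤ i)) (ℤP.*-identityˡ (g i)))

sum-sub-δ : ∀ {n} (i : Fin n) (f g : Fin n → ℤ) →
            sum (λ k → (f k - δ i k) * g k) ≡ sum (λ k → f k * g k) - g i
sum-sub-δ i f g = begin
  sum (λ k → (f k - δ i k) * g k)       ≡⟨ sum-cong-≗ (λ k → ℤP.*-distribʳ-+ (g k) (f k) (- δ i k)) ⟩
  sum (λ k → fg k + - δ i k * g k)      ≡⟨ ∑-distrib-+ fg (λ k → - δ i k * g k) ⟩
  sum fg + sum (λ k → - δ i k * g k)    ≡⟨ cong (λ s → sum fg + s) δ-part ⟩
  sum fg - g i                          ∎
  where
  open ≡-Reasoning
  fg : Fin _ → ℤ
  fg k = f k * g k
  δ-part : sum (λ k → - δ i k * g k) ≡ - g i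
  δ-part = trans (sum-cong-≗ λ k → sym (ℤP.neg-distribˡ-* (δ i k) (g k)))
                 (trans (sum-neg (λ k → δ i k * g k)) (cong -_ (sum-δ i g)))

sum-avoid : ∀ {n} (i : Fin n) (g : Fin n → ℤ) → sum (λ k → (1ℤ - δ i k) * g k) ≡ sum g - g i
sum-avoid i g = trans (sum-sub-δ i (λ _ → 1ℤ) g) (cong (_- g i) (sum-cong-≗ λ k → ℤP.*-identityˡ (g k)))

-- Increasing tuples

-- (k + 1)-tuples, as nested pairs
Tuple : ℕ → ℕ → Set
Tuple zero    n = Fin n
Tuple (suc k) n = Fin n × Tuple k n

first : ∀ {k n} → Tuple k n → Fin n
first {zero}  a       = a
first {suc k} (a , _) = a

shift : ∀ {k n} → Tuple k n → Tuple k (suc n)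
shift {zero}  a       = suc a
shift {suc k} (a , t) = suc a , shift t

Increasing : ∀ {k n} → Tuple k n → Set
Increasing {zero}  _       = ⊤
Increasing {suc k} (a , t) = a Fin.< first t × Increasing t

_∈ₜ_ : ∀ {k n} → Fin n → Tuple k n → Set
_∈ₜ_ {zero}  c a       = c ≡ a
_∈ₜ_ {suc k} c (a , t) = c ≡ a ⊎ c ∈ₜ t

sumIncreasing : ∀ k n → (Tuple k n → ℤ) → ℤ
sumIncreasing zero    n       f = sum f
sumIncreasing (suc k) zero    f = 0ℤ
sumIncreasing (suc k) (suc n) f =
  sumIncreasing k n (λ t → f (zero , shift t)) + sumIncreasing (suc k) n (f ∘ shift)

-- sumDeletions k H u = Σ over the entries c of u of H (u without c) c
sumDeletions : ∀ k {n} → (Tuple k n → Fin n → ℤ) → Tuple (suc k) n → ℤ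
sumDeletions zero    H (x , y) = H y x + H x y
sumDeletions (suc k) H (x , t) = H t x + sumDeletions k (λ t′ c → H (x , t′) c) t

first-shift : ∀ {k n} (t : Tuple k n) → first (shift t) ≡ suc (first t)
first-shift {zero}  t = refl
first-shift {suc k} t = refl

shift-increasing : ∀ {k n} (t : Tuple k n) → Increasing t → Increasing (shift t)
shift-increasing {zero}  t       _          = tt
shift-increasing {suc k} (a , t) (a<t , it) rewrite first-shift t = s≤s a<t , shift-increasing t it

cons-shift-increasing : ∀ {k n} (t : Tuple k n) → Increasing t → Increasing {suc k} (zero , shift t)
cons-shift-increasing t it rewrite first-shift t = s≤s z≤n , shift-increasing t it

∈ₜ-shift : ∀ {k n} {c : Fin n} (t : Tuple k n) → c ∈ₜ t → suc c ∈ₜ shift t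
∈ₜ-shift {zero}  t       c≡a        = cong suc c≡a
∈ₜ-shift {suc k} (a , t) (inj₁ c≡a) = inj₁ (cong suc c≡a)
∈ₜ-shift {suc k} (a , t) (inj₂ c∈t) = inj₂ (∈ₜ-shift t c∈t)

sumIncreasing-cong : ∀ k n {f g : Tuple k n → ℤ} → (∀ t → Increasing t → f t ≡ g t) →
                     sumIncreasing k n f ≡ sumIncreasing k n g
sumIncreasing-cong zero    n       f≗g = sum-cong-≗ (λ t → f≗g t tt)
sumIncreasing-cong (suc k) zero    f≗g = refl
sumIncreasing-cong (suc k) (suc n) f≗g = cong₂ _+_
  (sumIncreasing-cong k n (λ t it → f≗g _ (cons-shift-increasing t it)))
  (sumIncreasing-cong (suc k) n (λ t it → f≗g _ (shift-increasing t it)))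

sumIncreasing-+ : ∀ k n (f g : Tuple k n → ℤ) →
  sumIncreasing k n (λ t → f t + g t) ≡ sumIncreasing k n f + sumIncreasing k n g
sumIncreasing-+ zero    n       f g = ∑-distrib-+ f g
sumIncreasing-+ (suc k) zero    f g = refl
sumIncreasing-+ (suc k) (suc n) f g = trans
  (cong₂ _+_ (sumIncreasing-+ k n (λ t → f (zero , shift t)) (λ t → g (zero , shift t)))
             (sumIncreasing-+ (suc k) n (f ∘ shift) (g ∘ shift)))
  (+-interchange (sumIncreasing k n (λ t → f (zero , shift t))) _ (sumIncreasing (suc k) n (f ∘ shift)) _)
  where
  +-interchange : ∀ a b c d → a + b + (c + d) ≡ a + c + (b + d)
  +-interchange = solve-∀

sumIncreasing-*ˡ : ∀ k n (c : ℤ) (f : Tuple k n → ℤ) →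
  sumIncreasing k n (λ t → c * f t) ≡ c * sumIncreasing k n f
sumIncreasing-*ˡ zero    n       c f = sym (*-distribˡ-sum c f)
sumIncreasing-*ˡ (suc k) zero    c f = sym (ℤP.*-zeroʳ c)
sumIncreasing-*ˡ (suc k) (suc n) c f = trans
  (cong₂ _+_ (sumIncreasing-*ˡ k n c _) (sumIncreasing-*ˡ (suc k) n c _))
  (sym (ℤP.*-distribˡ-+ c _ _))

sumDeletions-shift : ∀ k {n} (H : Tuple k (suc n) → Fin (suc n) → ℤ) (u : Tuple (suc k) n) →
  sumDeletions k H (shift u) ≡ sumDeletions k (λ t c → H (shift t) (suc c)) u
sumDeletions-shift zero    H (x , y) = refl
sumDeletions-shift (suc k) H (x , t) =
  cong (λ s → H (shift t) (suc x) + s) (sumDeletions-shift k (λ t′ c → H (suc x , t′) c) t)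

sumDeletions-cong : ∀ k {n} {H H′ : Tuple k n → Fin n → ℤ} → (∀ t c → H t c ≡ H′ t c) →
                    ∀ u → sumDeletions k H u ≡ sumDeletions k H′ u
sumDeletions-cong zero    H≗H′ (x , y) = cong₂ _+_ (H≗H′ y x) (H≗H′ x y)
sumDeletions-cong (suc k) H≗H′ (x , t) =
  cong₂ _+_ (H≗H′ t x) (sumDeletions-cong k (λ t′ c → H≗H′ (x , t′) c) t)

sumDeletions-sum : ∀ k {n m} (H : Tuple k n → Fin n → Fin m → ℤ) u →
  sumDeletions k (λ t c → sum (H t c)) u ≡ sum (λ e → sumDeletions k (λ t c → H t c e) u)
sumDeletions-sum zero    H (x , y) = sym (∑-distrib-+ (H y x) (H x y))
sumDeletions-sum (suc k) H (x , t) = trans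
  (cong (λ s → sum (H t x) + s) (sumDeletions-sum k (λ t′ c → H (x , t′) c) t))
  (sym (∑-distrib-+ (H t x) (λ e → sumDeletions k (λ t′ c → H (x , t′) c e) t)))

-- A pair (t , c) with c ∉ t is (u without c , c) for exactly one increasing u; the induction on n
-- separates the terms in which the index 0 occurs.
sumIncreasing-sumDeletions : ∀ k n (H : Tuple k n → Fin n → ℤ) → (∀ t c → c ∈ₜ t → H t c ≡ 0ℤ) →
  sumIncreasing k n (λ t → sum (H t)) ≡ sumIncreasing (suc k) n (sumDeletions k H)
sumIncreasing-sumDeletions zero    zero    H H-vanishes = refl
sumIncreasing-sumDeletions (suc k) zero    H H-vanishes = refl
sumIncreasing-sumDeletions zero    (suc n) H H-vanishes = begin
  H zero zero + row₀ + sum (λ a → H (suc a) zero + sum (H₁ a))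
    ≡⟨ cong₂ (λ h s → h + row₀ + s) (H-vanishes zero zero refl)
             (∑-distrib-+ (λ a → H (suc a) zero) (sum ∘ H₁)) ⟩
  0ℤ + row₀ + (col₀ + sum (sum ∘ H₁))
    ≡⟨ cong (λ s → 0ℤ + row₀ + (col₀ + s)) (sumIncreasing-sumDeletions zero n H₁ H₁-vanishes) ⟩
  0ℤ + row₀ + (col₀ + rest)
    ≡⟨ rearrange row₀ col₀ rest ⟩
  col₀ + row₀ + rest
    ≡⟨ cong (_+ rest) (∑-distrib-+ (λ a → H (suc a) zero) (λ a → H zero (suc a))) ⟨
  sum (λ a → H (suc a) zero + H zero (suc a)) + rest ∎
  where
  open ≡-Reasoning
  H₁ : Fin n → Fin n → ℤ
  H₁ a c = H (suc a) (suc c)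
  H₁-vanishes : ∀ a c → c ≡ a → H₁ a c ≡ 0ℤ
  H₁-vanishes a c c≡a = H-vanishes (suc a) (suc c) (cong suc c≡a)
  row₀ col₀ rest : ℤ
  row₀ = sum (λ c → H zero (suc c))
  col₀ = sum (λ a → H (suc a) zero)
  rest = sumIncreasing 1 n (sumDeletions zero H₁)
  rearrange : ∀ r c s → 0ℤ + r + (c + s) ≡ c + r + s
  rearrange = solve-∀
sumIncreasing-sumDeletions (suc k) (suc n) H H-vanishes = begin
  sumIncreasing k n (λ t → sum (H (zero , shift t))) + sumIncreasing (suc k) n (λ t → sum (H (shift t)))
    ≡⟨ cong₂ _+_ containing-0 avoiding-0 ⟩
  D₀ + (col₀ + D₁)
    ≡⟨ rearrange D₀ col₀ D₁ ⟩
  col₀ + D₀ + D₁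
    ≡⟨ cong₂ _+_ (sumIncreasing-+ (suc k) n (λ u → H (shift u) zero) (sumDeletions k H₀)) deletions-avoiding-0 ⟨
  sumIncreasing (suc k) n (λ u → H (shift u) zero + sumDeletions k H₀ u)
    + sumIncreasing (suc (suc k)) n (sumDeletions (suc k) H ∘ shift)
    ≡⟨ cong (_+ sumIncreasing (suc (suc k)) n (sumDeletions (suc k) H ∘ shift)) deletions-containing-0 ⟨
  sumIncreasing (suc (suc k)) (suc n) (sumDeletions (suc k) H) ∎
  where
  open ≡-Reasoning
  H₀ : Tuple k n → Fin n → ℤ
  H₀ t c = H (zero , shift t) (suc c)
  H₁ : Tuple (suc k) n → Fin n → ℤ
  H₁ t c = H (shift t) (suc c)
  col₀ D₀ D₁ : ℤ
  col₀ = sumIncreasing (suc k) n (λ t → H (shift t) zero)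
  D₀   = sumIncreasing (suc k) n (sumDeletions k H₀)
  D₁   = sumIncreasing (suc (suc k)) n (sumDeletions (suc k) H₁)
  containing-0 : sumIncreasing k n (λ t → sum (H (zero , shift t))) ≡ D₀
  containing-0 = trans
    (sumIncreasing-cong k n λ t _ →
      trans (cong (λ h → h + sum (H₀ t)) (H-vanishes _ zero (inj₁ refl))) (ℤP.+-identityˡ (sum (H₀ t))))
    (sumIncreasing-sumDeletions k n H₀ λ t c c∈t → H-vanishes _ _ (inj₂ (∈ₜ-shift t c∈t)))
  avoiding-0 : sumIncreasing (suc k) n (λ t → sum (H (shift t))) ≡ col₀ + D₁
  avoiding-0 = trans
    (sumIncreasing-+ (suc k) n (λ t → H (shift t) zero) (sum ∘ H₁))
    (cong (λ s → col₀ + s)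
          (sumIncreasing-sumDeletions (suc k) n H₁ λ t c c∈t → H-vanishes _ _ (∈ₜ-shift t c∈t)))
  deletions-containing-0 : sumIncreasing (suc k) n (λ u → sumDeletions (suc k) H (zero , shift u))
                         ≡ sumIncreasing (suc k) n (λ u → H (shift u) zero + sumDeletions k H₀ u)
  deletions-containing-0 = sumIncreasing-cong (suc k) n λ u _ →
    cong (λ s → H (shift u) zero + s) (sumDeletions-shift k (λ t c → H (zero , t) c) u)
  deletions-avoiding-0 : sumIncreasing (suc (suc k)) n (sumDeletions (suc k) H ∘ shift) ≡ D₁
  deletions-avoiding-0 = sumIncreasing-cong (suc (suc k)) n λ u _ → sumDeletions-shift (suc k) H u
  rearrange : ∀ a c b → a + (c + b) ≡ c + a + b
  rearrange = solve-∀

countIncreasing : ℕ → ℕ → ℤ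
countIncreasing k n = sumIncreasing k n (λ _ → 1ℤ)

countIncreasing-0 : ∀ n → countIncreasing 0 n ≡ + n
countIncreasing-0 n = trans (sum-const n 1ℤ) (ℤP.*-identityʳ (+ n))

countIncreasing-1 : ∀ n → + 2 * countIncreasing 1 n ≡ + n * (+ n - 1ℤ)
countIncreasing-1 zero    = refl
countIncreasing-1 (suc n) = begin
  + 2 * (countIncreasing 0 n + countIncreasing 1 n)
    ≡⟨ ℤP.*-distribˡ-+ (+ 2) (countIncreasing 0 n) (countIncreasing 1 n) ⟩
  + 2 * countIncreasing 0 n + + 2 * countIncreasing 1 n
    ≡⟨ cong₂ (λ a b → + 2 * a + b) (countIncreasing-0 n) (countIncreasing-1 n) ⟩
  + 2 * + n + + n * (+ n - 1ℤ)                        ≡⟨ pascal (+ n) ⟩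
  + suc n * (+ suc n - 1ℤ)                            ∎
  where
  open ≡-Reasoning
  pascal : ∀ m → + 2 * m + m * (m - 1ℤ) ≡ (1ℤ + m) * ((1ℤ + m) - 1ℤ)
  pascal = solve-∀

countIncreasing-2 : ∀ n → + 6 * countIncreasing 2 n ≡ + n * ((+ n - 1ℤ) * (+ n - + 2))
countIncreasing-2 zero    = refl
countIncreasing-2 (suc n) = begin
  + 6 * (countIncreasing 1 n + countIncreasing 2 n)        ≡⟨ split (countIncreasing 1 n) (countIncreasing 2 n) ⟩
  + 3 * (+ 2 * countIncreasing 1 n) + + 6 * countIncreasing 2 n
    ≡⟨ cong₂ (λ a b → + 3 * a + b) (countIncreasing-1 n) (countIncreasing-2 n) ⟩
  + 3 * (+ n * (+ n - 1ℤ)) + + n * ((+ n - 1ℤ) * (+ n - + 2)) ≡⟨ pascal (+ n) ⟩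
  + suc n * ((+ suc n - 1ℤ) * (+ suc n - + 2))              ∎
  where
  open ≡-Reasoning
  split : ∀ x y → + 6 * (x + y) ≡ + 3 * (+ 2 * x) + + 6 * y
  split = solve-∀
  pascal : ∀ m → + 3 * (m * (m - 1ℤ)) + m * ((m - 1ℤ) * (m - + 2))
               ≡ (1ℤ + m) * (((1ℤ + m) - 1ℤ) * ((1ℤ + m) - + 2))
  pascal = solve-∀

countIncreasing-3 : ∀ n → + 24 * countIncreasing 3 n ≡ + n * ((+ n - 1ℤ) * ((+ n - + 2) * (+ n - + 3)))
countIncreasing-3 zero    = refl
countIncreasing-3 (suc n) = begin
  + 24 * (countIncreasing 2 n + countIncreasing 3 n)       ≡⟨ split (countIncreasing 2 n) (countIncreasing 3 n) ⟩
  + 4 * (+ 6 * countIncreasing 2 n) + + 24 * countIncreasing 3 n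
    ≡⟨ cong₂ (λ a b → + 4 * a + b) (countIncreasing-2 n) (countIncreasing-3 n) ⟩
  + 4 * (+ n * ((+ n - 1ℤ) * (+ n - + 2))) + + n * ((+ n - 1ℤ) * ((+ n - + 2) * (+ n - + 3)))
    ≡⟨ pascal (+ n) ⟩
  + suc n * ((+ suc n - 1ℤ) * ((+ suc n - + 2) * (+ suc n - + 3))) ∎
  where
  open ≡-Reasoning
  split : ∀ x y → + 24 * (x + y) ≡ + 4 * (+ 6 * x) + + 24 * y
  split = solve-∀
  pascal : ∀ m → + 4 * (m * ((m - 1ℤ) * (m - + 2))) + m * ((m - 1ℤ) * ((m - + 2) * (m - + 3)))
               ≡ (1ℤ + m) * (((1ℤ + m) - 1ℤ) * (((1ℤ + m) - + 2) * ((1ℤ + m) - + 3)))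
  pascal = solve-∀

fullTuple : ∀ k → Tuple k (suc k)
fullTuple zero    = zero
fullTuple (suc k) = zero , shift (fullTuple k)

sumIncreasing-tooShort : ∀ k m (f : Tuple k m → ℤ) → m ℕ.≤ k → sumIncreasing k m f ≡ 0ℤ
sumIncreasing-tooShort zero    zero    f _ = refl
sumIncreasing-tooShort (suc k) zero    f _ = refl
sumIncreasing-tooShort (suc k) (suc m) f (s≤s m≤k) = cong₂ _+_
  (sumIncreasing-tooShort k m (λ t → f (zero , shift t)) m≤k)
  (sumIncreasing-tooShort (suc k) m (f ∘ shift) (ℕP.m≤n⇒m≤1+n m≤k))

sumIncreasing-full : ∀ k (f : Tuple k (suc k) → ℤ) → sumIncreasing k (suc k) f ≡ f (fullTuple k)
sumIncreasing-full zero    f = ℤP.+-identityʳ (f zero)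
sumIncreasing-full (suc k) f = trans
  (cong₂ _+_ (sumIncreasing-full k (λ t → f (zero , shift t)))
             (sumIncreasing-tooShort (suc k) (suc k) (f ∘ shift) ℕP.≤-refl))
  (ℤP.+-identityʳ _)

increasingTuples : ∀ k n → List (Tuple k n)
increasingTuples zero    n       = allFin n
increasingTuples (suc k) zero    = []
increasingTuples (suc k) (suc n) =
  map (λ t → zero , shift t) (increasingTuples k n) ++ map shift (increasingTuples (suc k) n)

unshift : ∀ {k n} (t : Tuple k (suc n)) → Increasing t → Fin.zero {n} Fin.< first t →
          Σ (Tuple k n) λ u → shift u ≡ t × Increasing u
unshift {zero}  (suc u)     _          _ = u , refl , tt
unshift {suc k} (suc a , t) (a<t , it) _ with unshift t it (ℕP.<-trans (s≤s z≤n) a<t)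
... | u , refl , iu rewrite first-shift u = (a , u) , refl , ℕP.≤-pred a<t , iu

∈-increasingTuples⁺ : ∀ k n (t : Tuple k n) → Increasing t → t ∈ increasingTuples k n
∈-increasingTuples⁺ zero    n       t       _          = ∈-allFin t
∈-increasingTuples⁺ (suc k) (suc n) (zero , t) (0<t , it) with unshift t it 0<t
... | u , refl , iu = ∈-++⁺ˡ (∈-map⁺ (λ t → zero , shift t) (∈-increasingTuples⁺ k n u iu))
∈-increasingTuples⁺ (suc k) (suc n) (suc a , t) (a<t , it) with unshift t it (ℕP.<-trans (s≤s z≤n) a<t)
... | u , refl , iu rewrite first-shift u =
  ∈-++⁺ʳ _ (∈-map⁺ shift (∈-increasingTuples⁺ (suc k) n (a , u) (ℕP.≤-pred a<t , iu)))

∈-increasingTuples⁻ : ∀ k n (t : Tuple k n) → t ∈ increasingTuples k n → Increasing t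
∈-increasingTuples⁻ zero    n       t _ = tt
∈-increasingTuples⁻ (suc k) (suc n) t t∈ with ∈-++⁻ (map (λ t → zero , shift t) (increasingTuples k n)) t∈
... | inj₁ t∈₀ with ∈-map⁻ (λ t → zero , shift t) t∈₀
...   | u , u∈ , refl = cons-shift-increasing u (∈-increasingTuples⁻ k n u u∈)
∈-increasingTuples⁻ (suc k) (suc n) t t∈ | inj₂ t∈₁ with ∈-map⁻ shift t∈₁
...   | u , u∈ , refl = shift-increasing u (∈-increasingTuples⁻ (suc k) n u u∈)

shift-injective : ∀ {k n} {t u : Tuple k n} → shift t ≡ shift u → t ≡ u
shift-injective {zero}                        eq = FinP.suc-injective eq
shift-injective {suc k} {t = a , t} {b , u} eq
  with FinP.suc-injective (cong proj₁ eq) | shift-injective {t = t} {u} (cong proj₂ eq)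
... | refl | refl = refl

increasingTuples-unique : ∀ k n → Unique (increasingTuples k n)
increasingTuples-unique zero    n       = UniqueP.allFin⁺ n
increasingTuples-unique (suc k) zero    = Unique.[]
increasingTuples-unique (suc k) (suc n) = UniqueP.++⁺
  (UniqueP.map⁺ (shift-injective ∘ cong proj₂) (increasingTuples-unique k n))
  (UniqueP.map⁺ shift-injective (increasingTuples-unique (suc k) n))
  disjoint
  where
  disjoint : ∀ {v} → ¬ (v ∈ map (λ t → zero , shift t) (increasingTuples k n)
                      × v ∈ map shift (increasingTuples (suc k) n))
  disjoint (v∈₀ , v∈₁) with ∈-map⁻ (λ t → zero , shift t) v∈₀ | ∈-map⁻ shift v∈₁
  ... | _ , _ , refl | _ , _ , ()

sumList : List ℤ → ℤ
sumList = foldr _+_ 0ℤ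

sumList-++ : ∀ xs ys → sumList (xs ++ ys) ≡ sumList xs + sumList ys
sumList-++ []       ys = sym (ℤP.+-identityˡ _)
sumList-++ (x ∷ xs) ys = trans (cong (λ s → x + s) (sumList-++ xs ys)) (sym (ℤP.+-assoc x _ _))

sumList-tabulate : ∀ {n} (f : Fin n → ℤ) → sumList (tabulate f) ≡ sum f
sumList-tabulate {zero}  f = refl
sumList-tabulate {suc n} f = cong (λ s → f zero + s) (sumList-tabulate (f ∘ suc))

sumList-increasingTuples : ∀ k n (f : Tuple k n → ℤ) → sumList (map f (increasingTuples k n)) ≡ sumIncreasing k n f
sumList-increasingTuples zero    n       f = trans (cong sumList (ListP.map-tabulate (λ i → i) f)) (sumList-tabulate f)
sumList-increasingTuples (suc k) zero    f = refl
sumList-increasingTuples (suc k) (suc n) f = begin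
  sumList (map f (map (λ t → zero , shift t) ts₀ ++ map shift ts₁))
    ≡⟨ cong sumList (ListP.map-++ f (map (λ t → zero , shift t) ts₀) (map shift ts₁)) ⟩
  sumList (map f (map (λ t → zero , shift t) ts₀) ++ map f (map shift ts₁))
    ≡⟨ sumList-++ (map f (map (λ t → zero , shift t) ts₀)) (map f (map shift ts₁)) ⟩
  sumList (map f (map (λ t → zero , shift t) ts₀)) + sumList (map f (map shift ts₁))
    ≡⟨ cong₂ (λ xs ys → sumList xs + sumList ys) (ListP.map-∘ ts₀) (ListP.map-∘ ts₁) ⟨
  sumList (map (λ t → f (zero , shift t)) ts₀) + sumList (map (f ∘ shift) ts₁)
    ≡⟨ cong₂ _+_ (sumList-increasingTuples k n _) (sumList-increasingTuples (suc k) n _) ⟩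
  sumIncreasing (suc k) (suc n) f ∎
  where
  open ≡-Reasoning
  ts₀ : List (Tuple k n)
  ts₀ = increasingTuples k n
  ts₁ : List (Tuple (suc k) n)
  ts₁ = increasingTuples (suc k) n

indicator : ∀ {p} {P : Set p} → Dec P → ℤ
indicator P? = if does P? then 1ℤ else 0ℤ

length-filter≡sumList : ∀ {A : Set} {p} {P : Pred A p} (P? : Decidable P) (xs : List A) →
                + length (filter P? xs) ≡ sumList (map (indicator ∘ P?) xs)
length-filter≡sumList P? []       = refl
length-filter≡sumList P? (x ∷ xs) with does (P? x)
... | true  = cong (λ s → 1ℤ + s) (length-filter≡sumList P? xs)
... | false = trans (length-filter≡sumList P? xs) (sym (ℤP.+-identityˡ _))

-- Signed counts of 4-cycles

offDiag : ∀ {n} → Mat n → Mat n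
offDiag M i j with i Fin.≟ j
... | yes _ = 0ℤ
... | no _  = M i j

offDiag-diag : ∀ {n} (M : Mat n) i → offDiag M i i ≡ 0ℤ
offDiag-diag M i with i Fin.≟ i
... | yes _   = refl
... | no i≢i = contradiction refl i≢i

offDiag-off : ∀ {n} (M : Mat n) {i j} → i ≢ j → offDiag M i j ≡ M i j
offDiag-off M {i} {j} i≢j with i Fin.≟ j
... | yes i≡j = contradiction i≡j i≢j
... | no _    = refl

-- The squares make the term vanish when opposite corners of the 4-cycle coincide.
cycleTermOf : ∀ {n} → (Fin n → Fin n → ℤ) → Fin n → Fin n → Fin n → Fin n → ℤ
cycleTermOf S a b c d = S a b * S b c * S c d * S d a * (S a c * S a c) * (S b d * S b d)

cycleTerm : ∀ {n} → Mat n → Fin n → Fin n → Fin n → Fin n → ℤ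
cycleTerm M = cycleTermOf (offDiag M)

sum⁴ : ∀ {n} → (Fin n → Fin n → Fin n → Fin n → ℤ) → ℤ
sum⁴ G = sum λ a → sum λ b → sum λ c → sum λ d → G a b c d

cycleSum : ∀ {n} → Mat n → ℤ
cycleSum M = sum⁴ (cycleTerm M)

cycleTermOf-cong : ∀ {n} {S S′ : Fin n → Fin n → ℤ} → (∀ i j → S i j ≡ S′ i j) →
                   ∀ a b c d → cycleTermOf S a b c d ≡ cycleTermOf S′ a b c d
cycleTermOf-cong S≗S′ a b c d =
  cong₂ _*_ (cong₂ _*_ (cong₂ _*_ (cong₂ _*_ (cong₂ _*_ (S≗S′ a b) (S≗S′ b c)) (S≗S′ c d)) (S≗S′ d a))
                       (cong₂ _*_ (S≗S′ a c) (S≗S′ a c)))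
            (cong₂ _*_ (S≗S′ b d) (S≗S′ b d))

cycleSum-cong : ∀ {n} {M N : Mat n} → (∀ i j → M i j ≡ N i j) → cycleSum M ≡ cycleSum N
cycleSum-cong {M = M} {N} M≗N = sum-cong-≗ λ a → sum-cong-≗ λ b → sum-cong-≗ λ c → sum-cong-≗ λ d →
  cycleTermOf-cong offDiag-cong a b c d
  where
  offDiag-cong : ∀ i j → offDiag M i j ≡ offDiag N i j
  offDiag-cong i j with i Fin.≟ j
  ... | yes _ = refl
  ... | no _  = M≗N i j

record VanishesOnDiagonals {n} (G : Fin n → Fin n → Fin n → Fin n → ℤ) : Set where
  field
    ab : ∀ a c d → G a a c d ≡ 0ℤ
    ac : ∀ a b d → G a b a d ≡ 0ℤ
    ad : ∀ a b c → G a b c a ≡ 0ℤ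
    bc : ∀ a b d → G a b b d ≡ 0ℤ
    bd : ∀ a b c → G a b c b ≡ 0ℤ
    cd : ∀ a b c → G a b c c ≡ 0ℤ

cycleTermOf-vanishesOnDiagonals : ∀ {n} {S : Fin n → Fin n → ℤ} → (∀ i → S i i ≡ 0ℤ) →
                                  VanishesOnDiagonals (cycleTermOf S)
cycleTermOf-vanishesOnDiagonals {S = S} S-diag = record
  { ab = λ a c d → trans (cong (λ z → z * S a c * S c d * S d a * (S a c * S a c) * (S a d * S a d)) (S-diag a))
                         (zero₁ (S a c) (S c d) (S d a) (S a c) (S a d))
  ; ac = λ a b d → trans (cong (λ z → S a b * S b a * S a d * S d a * (z * z) * (S b d * S b d)) (S-diag a))
                         (zero₅ (S a b) (S b a) (S a d) (S d a) (S b d))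
  ; ad = λ a b c → trans (cong (λ z → S a b * S b c * S c a * z * (S a c * S a c) * (S b a * S b a)) (S-diag a))
                         (zero₄ (S a b) (S b c) (S c a) (S a c) (S b a))
  ; bc = λ a b d → trans (cong (λ z → S a b * z * S b d * S d a * (S a b * S a b) * (S b d * S b d)) (S-diag b))
                         (zero₂ (S a b) (S b d) (S d a) (S a b) (S b d))
  ; bd = λ a b c → trans (cong (λ z → S a b * S b c * S c b * S b a * (S a c * S a c) * (z * z)) (S-diag b))
                         (zero₆ (S a b) (S b c) (S c b) (S b a) (S a c))
  ; cd = λ a b c → trans (cong (λ z → S a b * S b c * z * S c a * (S a c * S a c) * (S b c * S b c)) (S-diag c))
                         (zero₃ (S a b) (S b c) (S c a) (S a c) (S b c))
  }
  where
  zero₁ : ∀ x₂ x₃ x₄ x₅ x₆ → 0ℤ * x₂ * x₃ * x₄ * (x₅ * x₅) * (x₆ * x₆) ≡ 0ℤ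
  zero₁ = solve-∀
  zero₂ : ∀ x₁ x₃ x₄ x₅ x₆ → x₁ * 0ℤ * x₃ * x₄ * (x₅ * x₅) * (x₆ * x₆) ≡ 0ℤ
  zero₂ = solve-∀
  zero₃ : ∀ x₁ x₂ x₄ x₅ x₆ → x₁ * x₂ * 0ℤ * x₄ * (x₅ * x₅) * (x₆ * x₆) ≡ 0ℤ
  zero₃ = solve-∀
  zero₄ : ∀ x₁ x₂ x₃ x₅ x₆ → x₁ * x₂ * x₃ * 0ℤ * (x₅ * x₅) * (x₆ * x₆) ≡ 0ℤ
  zero₄ = solve-∀
  zero₅ : ∀ x₁ x₂ x₃ x₄ x₆ → x₁ * x₂ * x₃ * x₄ * (0ℤ * 0ℤ) * (x₆ * x₆) ≡ 0ℤ
  zero₅ = solve-∀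
  zero₆ : ∀ x₁ x₂ x₃ x₄ x₅ → x₁ * x₂ * x₃ * x₄ * (x₅ * x₅) * (0ℤ * 0ℤ) ≡ 0ℤ
  zero₆ = solve-∀

cycleTerm-vanishesOnDiagonals : ∀ {n} (M : Mat n) → VanishesOnDiagonals (cycleTerm M)
cycleTerm-vanishesOnDiagonals M = cycleTermOf-vanishesOnDiagonals {S = offDiag M} (offDiag-diag M)

-- the sum of G over the 24 orderings of a 4-tuple
symmetrise : ∀ {n} → (Fin n → Fin n → Fin n → Fin n → ℤ) → Tuple 3 n → ℤ
symmetrise G = sumDeletions 2 (λ t d → sumDeletions 1 (λ t′ c → sumDeletions 0 (λ a b → G a b c d) t′) t)

symmetrise-cong : ∀ {n} {G G′ : Fin n → Fin n → Fin n → Fin n → ℤ} →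
                  (∀ a b c d → G a b c d ≡ G′ a b c d) → ∀ q → symmetrise G q ≡ symmetrise G′ q
symmetrise-cong G≗G′ = sumDeletions-cong 2 λ t d →
  sumDeletions-cong 1 (λ t′ c → sumDeletions-cong 0 (λ a b → G≗G′ a b c d) t′) t

sum⁴-symmetrise : ∀ {n} (G : Fin n → Fin n → Fin n → Fin n → ℤ) → VanishesOnDiagonals G →
                  sum⁴ G ≡ sumIncreasing 3 n (symmetrise G)
sum⁴-symmetrise {n} G G-vanishes = begin
  sum⁴ G
    ≡⟨ sumIncreasing-sumDeletions 0 n (λ a b → sum λ c → sum λ d → G a b c d) K₀-vanishes ⟩
  sumIncreasing 1 n (sumDeletions 0 (λ a b → sum λ c → sum λ d → G a b c d))
    ≡⟨ sumIncreasing-cong 1 n (λ t _ → trans (sumDeletions-sum 0 (λ a b c → sum (G a b c)) t)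
                                             (sum-cong-≗ λ c → sumDeletions-sum 0 (λ a b → G a b c) t)) ⟩
  sumIncreasing 1 n (λ t → sum λ c → sum λ d → K₁ t c d)
    ≡⟨ sumIncreasing-sumDeletions 1 n (λ t c → sum λ d → K₁ t c d) K₁-vanishes ⟩
  sumIncreasing 2 n (sumDeletions 1 (λ t c → sum λ d → K₁ t c d))
    ≡⟨ sumIncreasing-cong 2 n (λ t _ → sumDeletions-sum 1 K₁ t) ⟩
  sumIncreasing 2 n (λ t → sum λ d → K₂ t d)
    ≡⟨ sumIncreasing-sumDeletions 2 n K₂ K₂-vanishes ⟩
  sumIncreasing 3 n (symmetrise G) ∎
  where
  open ≡-Reasoning
  open VanishesOnDiagonals G-vanishes
  K₁ : Tuple 1 n → Fin n → Fin n → ℤ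
  K₁ t c d = sumDeletions 0 (λ a b → G a b c d) t
  K₂ : Tuple 2 n → Fin n → ℤ
  K₂ t d = sumDeletions 1 (λ t′ c → K₁ t′ c d) t
  K₀-vanishes : ∀ a b → b ≡ a → sum (λ c → sum λ d → G a b c d) ≡ 0ℤ
  K₀-vanishes a .a refl = sum-zero λ c → sum-zero λ d → ab a c d
  K₁-vanishes : ∀ t c → c ∈ₜ t → sum (λ d → K₁ t c d) ≡ 0ℤ
  K₁-vanishes (x , y) .x (inj₁ refl) = sum-zero λ d → cong₂ _+_ (bc y x d) (ac x y d)
  K₁-vanishes (x , y) .y (inj₂ refl) = sum-zero λ d → cong₂ _+_ (ac y x d) (bc x y d)
  K₂-vanishes : ∀ t d → d ∈ₜ t → K₂ t d ≡ 0ℤ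
  K₂-vanishes (x , y , z) .x (inj₁ refl) =
    cong₂ _+_ (cong₂ _+_ (cd z y x) (cd y z x))
              (cong₂ _+_ (cong₂ _+_ (bd z x y) (ad x z y)) (cong₂ _+_ (bd y x z) (ad x y z)))
  K₂-vanishes (x , y , z) .y (inj₂ (inj₁ refl)) =
    cong₂ _+_ (cong₂ _+_ (bd z y x) (ad y z x))
              (cong₂ _+_ (cong₂ _+_ (cd z x y) (cd x z y)) (cong₂ _+_ (ad y x z) (bd x y z)))
  K₂-vanishes (x , y , z) .z (inj₂ (inj₂ refl)) =
    cong₂ _+_ (cong₂ _+_ (ad z y x) (bd y z x))
              (cong₂ _+_ (cong₂ _+_ (ad z x y) (bd x z y)) (cong₂ _+_ (cd y x z) (cd x y z)))

quadEntry : ∀ {n} → Quad n → Fin 4 → Fin n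
quadEntry (a , b , c , d) 0F = a
quadEntry (a , b , c , d) 1F = b
quadEntry (a , b , c , d) 2F = c
quadEntry (a , b , c , d) 3F = d

principal4-entry : ∀ {n} (M : Mat n) q i j → principal4 M q i j ≡ M (quadEntry q i) (quadEntry q j)
principal4-entry M (a , b , c , d) 0F 0F = refl
principal4-entry M (a , b , c , d) 0F 1F = refl
principal4-entry M (a , b , c , d) 0F 2F = refl
principal4-entry M (a , b , c , d) 0F 3F = refl
principal4-entry M (a , b , c , d) 1F 0F = refl
principal4-entry M (a , b , c , d) 1F 1F = refl
principal4-entry M (a , b , c , d) 1F 2F = refl
principal4-entry M (a , b , c , d) 1F 3F = refl
principal4-entry M (a , b , c , d) 2F 0F = refl
principal4-entry M (a , b , c , d) 2F 1F = refl
principal4-entry M (a , b , c , d) 2F 2F = refl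
principal4-entry M (a , b , c , d) 2F 3F = refl
principal4-entry M (a , b , c , d) 3F 0F = refl
principal4-entry M (a , b , c , d) 3F 1F = refl
principal4-entry M (a , b , c , d) 3F 2F = refl
principal4-entry M (a , b , c , d) 3F 3F = refl

quadEntry-injective : ∀ {n} {q : Quad n} → IncreasingQuad q → ∀ {i j} → quadEntry q i ≡ quadEntry q j → i ≡ j
quadEntry-injective {q = a , b , c , d} (a<b , b<c , c<d) = injective
  where
  a<c : a Fin.< c
  a<c = FinP.<-trans a<b b<c
  b<d : b Fin.< d
  b<d = FinP.<-trans b<c c<d
  a<d : a Fin.< d
  a<d = FinP.<-trans a<c c<d
  injective : ∀ {i j} → quadEntry (a , b , c , d) i ≡ quadEntry (a , b , c , d) j → i ≡ j
  injective {0F} {0F} _ = refl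
  injective {1F} {1F} _ = refl
  injective {2F} {2F} _ = refl
  injective {3F} {3F} _ = refl
  injective {0F} {1F} e = contradiction e (FinP.<⇒≢ a<b)
  injective {0F} {2F} e = contradiction e (FinP.<⇒≢ a<c)
  injective {0F} {3F} e = contradiction e (FinP.<⇒≢ a<d)
  injective {1F} {2F} e = contradiction e (FinP.<⇒≢ b<c)
  injective {1F} {3F} e = contradiction e (FinP.<⇒≢ b<d)
  injective {2F} {3F} e = contradiction e (FinP.<⇒≢ c<d)
  injective {1F} {0F} e = contradiction (sym e) (FinP.<⇒≢ a<b)
  injective {2F} {0F} e = contradiction (sym e) (FinP.<⇒≢ a<c)
  injective {3F} {0F} e = contradiction (sym e) (FinP.<⇒≢ a<d)
  injective {2F} {1F} e = contradiction (sym e) (FinP.<⇒≢ b<c)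
  injective {3F} {1F} e = contradiction (sym e) (FinP.<⇒≢ b<d)
  injective {3F} {2F} e = contradiction (sym e) (FinP.<⇒≢ c<d)

offDiag-principal4 : ∀ {n} (M : Mat n) {q} → IncreasingQuad q →
  ∀ i j → offDiag (principal4 M q) i j ≡ offDiag M (quadEntry q i) (quadEntry q j)
offDiag-principal4 M {q} inc i j with i Fin.≟ j
... | yes refl = sym (offDiag-diag M (quadEntry q i))
... | no i≢j  = trans (principal4-entry M q i j) (sym (offDiag-off M (i≢j ∘ quadEntry-injective inc)))

cycleSum-principal4 : ∀ {n} (M : Mat n) {q} → IncreasingQuad q →
                      cycleSum (principal4 M q) ≡ symmetrise (cycleTerm M) q
cycleSum-principal4 M {q@(a , b , c , d)} inc = begin
  cycleSum X
    ≡⟨ sum⁴-symmetrise (cycleTerm X) (cycleTerm-vanishesOnDiagonals X) ⟩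
  sumIncreasing 3 4 (symmetrise (cycleTerm X))
    ≡⟨ sumIncreasing-full 3 (symmetrise (cycleTerm X)) ⟩
  symmetrise (cycleTerm X) (fullTuple 3)
    ≡⟨ symmetrise-cong (cycleTermOf-cong (offDiag-principal4 M inc)) (fullTuple 3) ⟩
  symmetrise (cycleTerm M) q ∎
  where
  open ≡-Reasoning
  X : Mat 4
  X = principal4 M q

Increasing⇒IncreasingQuad : ∀ {n} {q : Quad n} → Increasing q → IncreasingQuad q
Increasing⇒IncreasingQuad (a<b , b<c , c<d , _) = a<b , b<c , c<d

IncreasingQuad⇒Increasing : ∀ {n} {q : Quad n} → IncreasingQuad q → Increasing q
IncreasingQuad⇒Increasing (a<b , b<c , c<d) = a<b , b<c , c<d , _

cycleSum≡sum-principal4 : ∀ {n} (M : Mat n) → cycleSum M ≡ sumIncreasing 3 n (cycleSum ∘ principal4 M)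
cycleSum≡sum-principal4 {n} M = trans (sum⁴-symmetrise (cycleTerm M) (cycleTerm-vanishesOnDiagonals M))
  (sumIncreasing-cong 3 n λ q inc → sym (cycleSum-principal4 M (Increasing⇒IncreasingQuad inc)))

-- Signed permutations

±1-sq : ∀ {x} → IsPM1 x → x * x ≡ 1ℤ
±1-sq (inj₁ refl) = refl
±1-sq (inj₂ refl) = refl

±1-* : ∀ {x y} → IsPM1 x → IsPM1 y → IsPM1 (x * y)
±1-* (inj₁ refl) (inj₁ refl) = inj₁ refl
±1-* (inj₁ refl) (inj₂ refl) = inj₂ refl
±1-* (inj₂ refl) (inj₁ refl) = inj₂ refl
±1-* (inj₂ refl) (inj₂ refl) = inj₁ refl

±1-nonzero : ∀ {x} → IsPM1 x → x ≢ 0ℤ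
±1-nonzero (inj₁ refl) ()
±1-nonzero (inj₂ refl) ()

record SignedPermutation (n : ℕ) : Set where
  field
    perm    : Permutation′ n
    sign    : Fin n → ℤ
    sign-±1 : ∀ i → IsPM1 (sign i)

open SignedPermutation

-- Pᵀ M P for the signed permutation matrix P whose column i is sign i times the basis vector perm i
conjugate : ∀ {n} → SignedPermutation n → Mat n → Mat n
conjugate σ M i j = sign σ i * (M (perm σ ⟨$⟩ʳ i) (perm σ ⟨$⟩ʳ j) * sign σ j)

conjugate-cong : ∀ {n} (σ : SignedPermutation n) {M N : Mat n} → (∀ i j → M i j ≡ N i j) →
                 ∀ i j → conjugate σ M i j ≡ conjugate σ N i j
conjugate-cong σ M≗N i j = cong (λ m → sign σ i * (m * sign σ j)) (M≗N (perm σ ⟨$⟩ʳ i) (perm σ ⟨$⟩ʳ j))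

perm-injective : ∀ {n} (σ : SignedPermutation n) {i j} → perm σ ⟨$⟩ʳ i ≡ perm σ ⟨$⟩ʳ j → i ≡ j
perm-injective σ = Injection.injective (↔⇒↣ (perm σ))

compose : ∀ {n} → SignedPermutation n → SignedPermutation n → SignedPermutation n
compose σ τ = record
  { perm    = perm σ ∘ₚ perm τ
  ; sign    = λ i → sign σ i * sign τ (perm σ ⟨$⟩ʳ i)
  ; sign-±1 = λ i → ±1-* (sign-±1 σ i) (sign-±1 τ _)
  }

conjugate-compose : ∀ {n} (σ τ : SignedPermutation n) M i j →
                    conjugate σ (conjugate τ M) i j ≡ conjugate (compose σ τ) M i j
conjugate-compose σ τ M i j =
  regroup (sign σ i) (sign τ (ρ i)) (M (π (ρ i)) (π (ρ j))) (sign τ (ρ j)) (sign σ j)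
  where
  ρ π : Fin _ → Fin _
  ρ = perm σ ⟨$⟩ʳ_
  π = perm τ ⟨$⟩ʳ_
  regroup : ∀ s t m t′ s′ → s * (t * (m * t′) * s′) ≡ s * t * (m * (s′ * t′))
  regroup = solve-∀

conjugation-formula : ∀ {n} (P M : Mat n) (ρ : Fin n → Fin n) → (∀ l j → l ≢ ρ j → P l j ≡ 0ℤ) →
                      ∀ i j → ((P ᵀ) ⊗ (M ⊗ P)) i j ≡ P (ρ i) i * (M (ρ i) (ρ j) * P (ρ j) j)
conjugation-formula P M ρ column-support i j = begin
  sumℤ (λ k → P k i * sumℤ (λ l → M k l * P l j))
    ≡⟨ trans (sumℤ≡sum (λ k → P k i * sumℤ (λ l → M k l * P l j))) (sum-cong-≗ λ k → cong (P k i *_) (inner k)) ⟩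
  sum (λ k → P k i * MPj k)
    ≡⟨ sum-single (λ k → P k i * MPj k) (ρ i) (λ k k≢ρi →
         trans (cong (_* MPj k) (column-support k i k≢ρi)) (ℤP.*-zeroˡ (MPj k))) ⟩
  P (ρ i) i * MPj (ρ i) ∎
  where
  open ≡-Reasoning
  MPj : Fin _ → ℤ
  MPj k = M k (ρ j) * P (ρ j) j
  inner : ∀ k → sumℤ (λ l → M k l * P l j) ≡ MPj k
  inner k = trans (sumℤ≡sum (λ l → M k l * P l j)) (sum-single (λ l → M k l * P l j) (ρ j) λ l l≢ρj →
              trans (cong (M k l *_) (column-support l j l≢ρj)) (ℤP.*-zeroʳ (M k l)))

matrix : ∀ {n} → SignedPermutation n → Mat n
matrix σ k i with k Fin.≟ perm σ ⟨$⟩ʳ i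
... | yes _ = sign σ i
... | no _  = 0ℤ

matrix-support : ∀ {n} (σ : SignedPermutation n) k i → k ≢ perm σ ⟨$⟩ʳ i → matrix σ k i ≡ 0ℤ
matrix-support σ k i k≢πi with k Fin.≟ perm σ ⟨$⟩ʳ i
... | yes k≡πi = contradiction k≡πi k≢πi
... | no _     = refl

matrix-entry : ∀ {n} (σ : SignedPermutation n) i → matrix σ (perm σ ⟨$⟩ʳ i) i ≡ sign σ i
matrix-entry σ i with perm σ ⟨$⟩ʳ i Fin.≟ perm σ ⟨$⟩ʳ i
... | yes _   = refl
... | no πi≢πi = contradiction refl πi≢πi

matrix-isSignedPerm : ∀ {n} (σ : SignedPermutation n) → IsSignedPerm (matrix σ)
matrix-isSignedPerm {n} σ = entries , rows , columns
  where
  π : Permutation′ n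
  π = perm σ
  nonzero : ∀ k i → matrix σ k i ≢ 0ℤ → k ≡ π ⟨$⟩ʳ i
  nonzero k i Pki≢0 with k Fin.≟ π ⟨$⟩ʳ i
  ... | yes k≡πi = k≡πi
  ... | no _     = contradiction refl Pki≢0
  entries : ∀ k i → (matrix σ k i ≡ 0ℤ) ⊎ IsPM1 (matrix σ k i)
  entries k i with k Fin.≟ π ⟨$⟩ʳ i
  ... | yes _ = inj₂ (sign-±1 σ i)
  ... | no _  = inj₁ refl
  rows : ∀ k → Σ (Fin n) λ i → (matrix σ k i ≢ 0ℤ) × (∀ i′ → matrix σ k i′ ≢ 0ℤ → i′ ≡ i)
  rows k = π ⟨$⟩ˡ k
         , subst (λ k′ → matrix σ k′ (π ⟨$⟩ˡ k) ≢ 0ℤ) (Perm.inverseʳ π)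
                 (subst (_≢ 0ℤ) (sym (matrix-entry σ _)) (±1-nonzero (sign-±1 σ _)))
         , λ i′ Pki′≢0 → trans (sym (Perm.inverseˡ π)) (cong (π ⟨$⟩ˡ_) (sym (nonzero k i′ Pki′≢0)))
  columns : ∀ i → Σ (Fin n) λ k → (matrix σ k i ≢ 0ℤ) × (∀ k′ → matrix σ k′ i ≢ 0ℤ → k′ ≡ k)
  columns i = π ⟨$⟩ʳ i
            , subst (_≢ 0ℤ) (sym (matrix-entry σ i)) (±1-nonzero (sign-±1 σ i))
            , λ k′ → nonzero k′ i

conjugate⇒SHEquiv : ∀ {n} (σ : SignedPermutation n) {X Y : Mat n} →
                    (∀ i j → Y i j ≡ conjugate σ X i j) → SHEquiv X Y
conjugate⇒SHEquiv σ {X} {Y} Y≗σX = matrix σ , matrix-isSignedPerm σ , λ i j → begin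
  Y i j
    ≡⟨ Y≗σX i j ⟩
  sign σ i * (X (π i) (π j) * sign σ j)
    ≡⟨ cong₂ (λ s t → s * (X (π i) (π j) * t)) (matrix-entry σ i) (matrix-entry σ j) ⟨
  matrix σ (π i) i * (X (π i) (π j) * matrix σ (π j) j)
    ≡⟨ conjugation-formula (matrix σ) X π (matrix-support σ) i j ⟨
  ((matrix σ ᵀ) ⊗ (X ⊗ matrix σ)) i j ∎
  where
  open ≡-Reasoning
  π : Fin _ → Fin _
  π = perm σ ⟨$⟩ʳ_

SHEquiv⇒conjugate : ∀ {n} {X Y : Mat n} → SHEquiv X Y →
                    Σ (SignedPermutation n) λ σ → ∀ i j → Y i j ≡ conjugate σ X i j
SHEquiv⇒conjugate {n} {X} {Y} (P , (entries , rows , columns) , Y≡PᵀXP) =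
  σ , λ i j → trans (Y≡PᵀXP i j) (conjugation-formula P X ρ support i j)
  where
  ρ ρ⁻¹ : Fin n → Fin n
  ρ   j = proj₁ (columns j)
  ρ⁻¹ k = proj₁ (rows k)
  support : ∀ k j → k ≢ ρ j → P k j ≡ 0ℤ
  support k j k≢ρj with entries k j
  ... | inj₁ Pkj≡0 = Pkj≡0
  ... | inj₂ Pkj±1 = contradiction (proj₂ (proj₂ (columns j)) k (±1-nonzero Pkj±1)) k≢ρj
  sign-±1′ : ∀ j → IsPM1 (P (ρ j) j)
  sign-±1′ j with entries (ρ j) j
  ... | inj₁ Pρjj≡0 = contradiction Pρjj≡0 (proj₁ (proj₂ (columns j)))
  ... | inj₂ Pρjj±1 = Pρjj±1
  σ : SignedPermutation n
  σ = record
    { perm    = permutation ρ ρ⁻¹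
                  (λ k → sym (proj₂ (proj₂ (columns (ρ⁻¹ k))) k (proj₁ (proj₂ (rows k)))))
                  (λ j → sym (proj₂ (proj₂ (rows (ρ j))) j (proj₁ (proj₂ (columns j)))))
    ; sign    = λ j → P (ρ j) j
    ; sign-±1 = sign-±1′
    }

offDiag-conjugate : ∀ {n} (σ : SignedPermutation n) M i j →
  offDiag (conjugate σ M) i j ≡ sign σ i * (offDiag M (perm σ ⟨$⟩ʳ i) (perm σ ⟨$⟩ʳ j) * sign σ j)
offDiag-conjugate σ M i j with i Fin.≟ j
... | yes refl = sym (trans (cong (λ s → sign σ i * (s * sign σ i)) (offDiag-diag M (perm σ ⟨$⟩ʳ i)))
                            (ℤP.*-zeroʳ (sign σ i)))
... | no i≢j  = cong (λ s → sign σ i * (s * sign σ j)) (sym (offDiag-off M (i≢j ∘ perm-injective σ)))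

-- every sign occurs to the fourth power in a cycle term
cycleTerm-conjugate : ∀ {n} (σ : SignedPermutation n) M a b c d →
  cycleTerm (conjugate σ M) a b c d ≡ cycleTerm M (perm σ ⟨$⟩ʳ a) (perm σ ⟨$⟩ʳ b) (perm σ ⟨$⟩ʳ c) (perm σ ⟨$⟩ʳ d)
cycleTerm-conjugate σ M a b c d = begin
  cycleTerm (conjugate σ M) a b c d
    ≡⟨ cycleTermOf-cong (offDiag-conjugate σ M) a b c d ⟩
  cycleTermOf (λ i j → t i * (S (π i) (π j) * t j)) a b c d
    ≡⟨ signs-factor (t a) (t b) (t c) (t d) (S (π a) (π b)) (S (π b) (π c))
                    (S (π c) (π d)) (S (π d) (π a)) (S (π a) (π c)) (S (π b) (π d)) ⟩
  (t a * t a) * (t b * t b) * ((t c * t c) * (t d * t d)) * ((t a * t a) * (t b * t b) * ((t c * t c) * (t d * t d)))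
    * cycleTermOf S (π a) (π b) (π c) (π d)
    ≡⟨ cong (λ x → x * x * cycleTermOf S (π a) (π b) (π c) (π d))
            (cong₂ _*_ (cong₂ _*_ (sq a) (sq b)) (cong₂ _*_ (sq c) (sq d))) ⟩
  1ℤ * cycleTermOf S (π a) (π b) (π c) (π d)
    ≡⟨ ℤP.*-identityˡ _ ⟩
  cycleTerm M (π a) (π b) (π c) (π d) ∎
  where
  open ≡-Reasoning
  π : Fin _ → Fin _
  π = perm σ ⟨$⟩ʳ_
  t : Fin _ → ℤ
  t = sign σ
  S : Fin _ → Fin _ → ℤ
  S = offDiag M
  sq : ∀ i → t i * t i ≡ 1ℤ
  sq i = ±1-sq (sign-±1 σ i)
  signs-factor : ∀ ta tb tc td x₁ x₂ x₃ x₄ x₅ x₆ →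
    ta * (x₁ * tb) * (tb * (x₂ * tc)) * (tc * (x₃ * td)) * (td * (x₄ * ta))
      * (ta * (x₅ * tc) * (ta * (x₅ * tc))) * (tb * (x₆ * td) * (tb * (x₆ * td)))
    ≡ (ta * ta) * (tb * tb) * ((tc * tc) * (td * td)) * ((ta * ta) * (tb * tb) * ((tc * tc) * (td * td)))
      * (x₁ * x₂ * x₃ * x₄ * (x₅ * x₅) * (x₆ * x₆))
  signs-factor = solve-∀

sum⁴-permute : ∀ {n} (G : Fin n → Fin n → Fin n → Fin n → ℤ) (π : Permutation′ n) →
  sum⁴ (λ a b c d → G (π ⟨$⟩ʳ a) (π ⟨$⟩ʳ b) (π ⟨$⟩ʳ c) (π ⟨$⟩ʳ d)) ≡ sum⁴ G
sum⁴-permute G π =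
  trans (sum-cong-≗ λ a → sum-cong-≗ λ b → sum-cong-≗ λ c → sym (sum-permute (G (ρ a) (ρ b) (ρ c)) π))
  (trans (sum-cong-≗ λ a → sum-cong-≗ λ b → sym (sum-permute (λ c → sum (G (ρ a) (ρ b) c)) π))
  (trans (sum-cong-≗ λ a → sym (sum-permute (λ b → sum λ c → sum (G (ρ a) b c)) π))
         (sym (sum-permute (λ a → sum λ b → sum λ c → sum (G a b c)) π))))
  where
  ρ : Fin _ → Fin _
  ρ = π ⟨$⟩ʳ_

cycleSum-conjugate : ∀ {n} (σ : SignedPermutation n) M → cycleSum (conjugate σ M) ≡ cycleSum M
cycleSum-conjugate σ M = trans
  (sum-cong-≗ λ a → sum-cong-≗ λ b → sum-cong-≗ λ c → sum-cong-≗ λ d → cycleTerm-conjugate σ M a b c d)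
  (sum⁴-permute (cycleTerm M) (perm σ))

-- Skew matrices

record IsSkewType {n} (M : Mat n) : Set where
  field
    diag : ∀ i → M i i ≡ 1ℤ
    ±1   : ∀ i j → IsPM1 (M i j)
    skew : ∀ {i j} → i ≢ j → M j i ≡ - M i j

skewHadamard⇒skewType : ∀ {n} {H : Mat n} → IsSkewHadamard n H → IsSkewType H
skewHadamard⇒skewType {n} {H} ((±1 , _) , H+Hᵀ≡2I) = record { diag = diag ; ±1 = ±1 ; skew = skew }
  where
  diag : ∀ i → H i i ≡ 1ℤ
  diag i with ±1 i i
  ... | inj₁ Hii≡1  = Hii≡1
  ... | inj₂ Hii≡-1 = contradiction
    (trans (cong (λ h → h + h) (sym Hii≡-1)) (trans (H+Hᵀ≡2I i i) (scalarI-diag (+ 2) i))) λ ()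
  skew : ∀ {i j} → i ≢ j → H j i ≡ - H i j
  skew {i} {j} i≢j = begin
    H j i                     ≡⟨ cancel (H i j) (H j i) ⟩
    - H i j + (H i j + H j i) ≡⟨ cong (λ s → - H i j + s) (trans (H+Hᵀ≡2I i j) (scalarI-off (+ 2) i≢j)) ⟩
    - H i j + 0ℤ              ≡⟨ ℤP.+-identityʳ (- H i j) ⟩
    - H i j                   ∎
    where
    open ≡-Reasoning
    cancel : ∀ a b → b ≡ - a + (a + b)
    cancel = solve-∀

principal4-skewType : ∀ {n} {M : Mat n} {q} → IsSkewType M → IncreasingQuad q → IsSkewType (principal4 M q)
principal4-skewType {M = M} {q} M-skew inc = record
  { diag = λ i → trans (principal4-entry M q i i) (diag (quadEntry q i))
  ; ±1   = λ i j → subst IsPM1 (sym (principal4-entry M q i j)) (±1 (quadEntry q i) (quadEntry q j))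
  ; skew = λ {i} {j} i≢j → trans (principal4-entry M q j i)
             (trans (skew (i≢j ∘ quadEntry-injective inc)) (cong -_ (sym (principal4-entry M q i j))))
  }
  where open IsSkewType M-skew

conjugate-skewType : ∀ {n} (σ : SignedPermutation n) {M : Mat n} → IsSkewType M → IsSkewType (conjugate σ M)
conjugate-skewType σ {M} M-skew = record
  { diag = λ i → trans (cong (λ m → t i * (m * t i)) (diag (π i)))
                       (trans (cong (t i *_) (ℤP.*-identityˡ (t i))) (sq i))
  ; ±1   = λ i j → ±1-* (sign-±1 σ i) (±1-* (±1 (π i) (π j)) (sign-±1 σ j))
  ; skew = λ {i} {j} i≢j → trans (cong (λ m → t j * (m * t i)) (skew (i≢j ∘ perm-injective σ)))
                                 (swap (t i) (M (π i) (π j)) (t j))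
  }
  where
  open IsSkewType M-skew
  π : Fin _ → Fin _
  π = perm σ ⟨$⟩ʳ_
  t : Fin _ → ℤ
  t = sign σ
  sq : ∀ i → t i * t i ≡ 1ℤ
  sq i = ±1-sq (sign-±1 σ i)
  swap : ∀ s m s′ → s′ * (- m * s) ≡ - (s * (m * s′))
  swap = solve-∀

module SkewTypeOffDiagonal {n} {M : Mat n} (M-skew : IsSkewType M) where
  open IsSkewType M-skew

  S : Fin n → Fin n → ℤ
  S = offDiag M

  S-skew : ∀ i j → S j i ≡ - S i j
  S-skew i j with i Fin.≟ j
  ... | yes refl = offDiag-diag M i
  ... | no i≢j  = trans (offDiag-off M (i≢j ∘ sym)) (skew i≢j)

  S-sq : ∀ i j → S i j * S i j ≡ 1ℤ - δ i j
  S-sq i j with i Fin.≟ j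
  ... | yes refl = refl
  ... | no i≢j  = ±1-sq (±1 i j)

  S≡M-δ : ∀ i j → S i j ≡ M i j - δ i j
  S≡M-δ i j with i Fin.≟ j
  ... | yes refl = sym (cong (_- 1ℤ) (diag i))
  ... | no i≢j  = sym (ℤP.+-identityʳ (M i j))

-- Skew matrices of order 4

-- As a tournament: vertex 0 beats the other three, and x, y, z orient the edges 12, 13, 23.
normalForm : ℤ → ℤ → ℤ → Mat 4
normalForm x y z 0F 0F = 1ℤ
normalForm x y z 0F _  = 1ℤ
normalForm x y z _  0F = -1ℤ
normalForm x y z 1F 1F = 1ℤ
normalForm x y z 1F 2F = x
normalForm x y z 1F 3F = y
normalForm x y z 2F 1F = - x
normalForm x y z 2F 2F = 1ℤ
normalForm x y z 2F 3F = z
normalForm x y z 3F 1F = - y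
normalForm x y z 3F 2F = - z
normalForm x y z 3F 3F = 1ℤ

module _ {Y : Mat 4} (Y-skew : IsSkewType Y) (firstRow : ∀ j → Y 0F j ≡ 1ℤ) where
  open IsSkewType Y-skew

  firstColumn : ∀ {i} → i ≢ 0F → Y i 0F ≡ -1ℤ
  firstColumn {i} i≢0 = trans (skew (i≢0 ∘ sym)) (cong -_ (firstRow i))

  skewType≗normalForm : ∀ i j → Y i j ≡ normalForm (Y 1F 2F) (Y 1F 3F) (Y 2F 3F) i j
  skewType≗normalForm 0F j  = trans (firstRow j) (sym (normalForm-firstRow j))
    where
    normalForm-firstRow : ∀ j → normalForm (Y 1F 2F) (Y 1F 3F) (Y 2F 3F) 0F j ≡ 1ℤ
    normalForm-firstRow 0F = refl
    normalForm-firstRow 1F = refl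
    normalForm-firstRow 2F = refl
    normalForm-firstRow 3F = refl
  skewType≗normalForm 1F 0F = firstColumn λ ()
  skewType≗normalForm 2F 0F = firstColumn λ ()
  skewType≗normalForm 3F 0F = firstColumn λ ()
  skewType≗normalForm 1F 1F = diag 1F
  skewType≗normalForm 2F 2F = diag 2F
  skewType≗normalForm 3F 3F = diag 3F
  skewType≗normalForm 1F 2F = refl
  skewType≗normalForm 1F 3F = refl
  skewType≗normalForm 2F 3F = refl
  skewType≗normalForm 2F 1F = skew λ ()
  skewType≗normalForm 3F 1F = skew λ ()
  skewType≗normalForm 3F 2F = skew λ ()

relabelling : Permutation′ 4 → SignedPermutation 4
relabelling π = record { perm = π ; sign = λ _ → 1ℤ ; sign-±1 = λ _ → inj₁ refl }

entrywise : (M N : Mat 4) → Dec (∀ i j → M i j ≡ N i j)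
entrywise M N = FinP.all? λ i → FinP.all? λ j → M i j ℤ.≟ N i j

relabels-to-A : ∀ {x y z} (π : Permutation′ 4) → {True (entrywise A (conjugate (relabelling π) (normalForm x y z)))} →
                Σ (SignedPermutation 4) λ σ → ∀ i j → A i j ≡ conjugate σ (normalForm x y z) i j
relabels-to-A π {A≗πN} = relabelling π , toWitness A≗πN

-- A transitive tournament is A after ordering its vertices by decreasing score; a cyclic one has cycleSum -24.
normalForm-cycleSum-cases : ∀ {x y z} → IsPM1 x → IsPM1 y → IsPM1 z →
  (cycleSum (normalForm x y z) ≡ -[1+ 23 ]) ⊎
  (cycleSum (normalForm x y z) ≡ + 8 × Σ (SignedPermutation 4) λ σ → ∀ i j → A i j ≡ conjugate σ (normalForm x y z) i j)
normalForm-cycleSum-cases (inj₁ refl) (inj₁ refl) (inj₁ refl) = inj₂ (refl , relabels-to-A Perm.id)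
normalForm-cycleSum-cases (inj₁ refl) (inj₁ refl) (inj₂ refl) = inj₂ (refl , relabels-to-A (transpose 2F 3F))
normalForm-cycleSum-cases (inj₁ refl) (inj₂ refl) (inj₁ refl) = inj₁ refl
normalForm-cycleSum-cases (inj₁ refl) (inj₂ refl) (inj₂ refl) = inj₂ (refl , relabels-to-A (transpose 2F 3F ∘ₚ transpose 1F 3F))
normalForm-cycleSum-cases (inj₂ refl) (inj₁ refl) (inj₁ refl) = inj₂ (refl , relabels-to-A (transpose 1F 2F))
normalForm-cycleSum-cases (inj₂ refl) (inj₁ refl) (inj₂ refl) = inj₁ refl
normalForm-cycleSum-cases (inj₂ refl) (inj₂ refl) (inj₁ refl) = inj₂ (refl , relabels-to-A (transpose 2F 3F ∘ₚ transpose 1F 2F))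
normalForm-cycleSum-cases (inj₂ refl) (inj₂ refl) (inj₂ refl) = inj₂ (refl , relabels-to-A (transpose 1F 3F))

SHEquiv⇒cycleSum≡ : ∀ {n} {X Y : Mat n} → SHEquiv X Y → cycleSum Y ≡ cycleSum X
SHEquiv⇒cycleSum≡ {X = X} {Y} X∼Y with SHEquiv⇒conjugate {X = X} {Y} X∼Y
... | σ , Y≗σX = trans (cycleSum-cong {N = conjugate σ X} Y≗σX) (cycleSum-conjugate σ X)

module SkewType4 {X : Mat 4} (X-skew : IsSkewType X) where
  open IsSkewType X-skew

  normaliser : SignedPermutation 4
  normaliser = record { perm = Perm.id ; sign = X 0F ; sign-±1 = ±1 0F }

  Y : Mat 4
  Y = conjugate normaliser X

  Y-firstRow : ∀ j → Y 0F j ≡ 1ℤ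
  Y-firstRow j = trans (cong (λ x → x * (X 0F j * X 0F j)) (diag 0F))
                       (trans (ℤP.*-identityˡ (X 0F j * X 0F j)) (±1-sq (±1 0F j)))

  Y≗normalForm : ∀ i j → Y i j ≡ normalForm (Y 1F 2F) (Y 1F 3F) (Y 2F 3F) i j
  Y≗normalForm = skewType≗normalForm (conjugate-skewType normaliser X-skew) Y-firstRow

  Y-±1 : ∀ i j → IsPM1 (Y i j)
  Y-±1 = IsSkewType.±1 (conjugate-skewType normaliser X-skew)

  cycleSum≡normalForm : cycleSum X ≡ cycleSum (normalForm (Y 1F 2F) (Y 1F 3F) (Y 2F 3F))
  cycleSum≡normalForm = trans (sym (cycleSum-conjugate normaliser X)) (cycleSum-cong Y≗normalForm)

  cycleSum-cases : (cycleSum X ≡ -[1+ 23 ]) ⊎ (cycleSum X ≡ + 8 × SHEquiv X A)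
  cycleSum-cases = fromNormalForm (normalForm-cycleSum-cases {Y 1F 2F} {Y 1F 3F} {Y 2F 3F}
                                                             (Y-±1 1F 2F) (Y-±1 1F 3F) (Y-±1 2F 3F))
    where
    N : Mat 4
    N = normalForm (Y 1F 2F) (Y 1F 3F) (Y 2F 3F)
    fromNormalForm : (cycleSum N ≡ -[1+ 23 ]) ⊎
                     (cycleSum N ≡ + 8 × Σ (SignedPermutation 4) λ σ → ∀ i j → A i j ≡ conjugate σ N i j) →
                     (cycleSum X ≡ -[1+ 23 ]) ⊎ (cycleSum X ≡ + 8 × SHEquiv X A)
    fromNormalForm (inj₁ cyclic)                   = inj₁ (trans cycleSum≡normalForm cyclic)
    fromNormalForm (inj₂ (transitive , σ , A≗σN)) =
      inj₂ (trans cycleSum≡normalForm transitive , conjugate⇒SHEquiv (compose σ normaliser) {X} {A} A≗X)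
      where
      A≗X : ∀ i j → A i j ≡ conjugate (compose σ normaliser) X i j
      A≗X i j = trans (A≗σN i j) (trans (conjugate-cong σ {N} {Y} (λ k l → sym (Y≗normalForm k l)) i j)
                                        (conjugate-compose σ normaliser X i j))

  cycleSum≡8⇔SHEquiv-A : (cycleSum X ≡ + 8) ⇔ SHEquiv X A
  cycleSum≡8⇔SHEquiv-A = mk⇔ from-cycleSum (λ X∼A → sym (SHEquiv⇒cycleSum≡ {X = X} {A} X∼A))
    where
    from-cycleSum : cycleSum X ≡ + 8 → SHEquiv X A
    from-cycleSum transitive =
      [ (λ cyclic → contradiction (trans (sym transitive) cyclic) λ ()) , proj₂ ]′ cycleSum-cases

  cycleSum≡8-indicator : + 32 * indicator (cycleSum X ℤ.≟ + 8) ≡ cycleSum X + + 24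
  cycleSum≡8-indicator = indicator-values {cycleSum X} (map₂ proj₁ cycleSum-cases)
    where
    indicator-values : ∀ {k} → (k ≡ -[1+ 23 ]) ⊎ (k ≡ + 8) → + 32 * indicator (k ℤ.≟ + 8) ≡ k + + 24
    indicator-values (inj₁ refl) = refl
    indicator-values (inj₂ refl) = refl

-- Skew Hadamard matrices

module SkewHadamard {n} {H : Mat n} (H-skewHadamard : IsSkewHadamard n H) where
  H-skew : IsSkewType H
  H-skew = skewHadamard⇒skewType H-skewHadamard
  open IsSkewType H-skew
  open SkewTypeOffDiagonal H-skew

  orthogonal : ∀ {i j} → i ≢ j → sum (λ k → H i k * H j k) ≡ 0ℤ
  orthogonal {i} {j} i≢j = trans (sym (sumℤ≡sum (λ k → H i k * H j k)))
                                 (trans (proj₂ (proj₁ H-skewHadamard) i j) (scalarI-off (+ n) i≢j))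

  S-orthogonal : ∀ {i j} → i ≢ j → sum (λ k → S i k * S j k) ≡ 0ℤ
  S-orthogonal {i} {j} i≢j = begin
    sum (λ k → S i k * S j k)
      ≡⟨ sum-cong-≗ (λ k → cong (_* S j k) (S≡M-δ i k)) ⟩
    sum (λ k → (H i k - δ i k) * S j k)
      ≡⟨ sum-sub-δ i (H i) (S j) ⟩
    sum (λ k → H i k * S j k) - S j i
      ≡⟨ cong (_- S j i) (sum-cong-≗ λ k → trans (ℤP.*-comm (H i k) (S j k)) (cong (_* H i k) (S≡M-δ j k))) ⟩
    sum (λ k → (H j k - δ j k) * H i k) - S j i
      ≡⟨ cong (_- S j i) (sum-sub-δ j (H j) (H i)) ⟩
    sum (λ k → H j k * H i k) - H i j - S j i
      ≡⟨ cong₂ (λ x y → x - H i j - y) (orthogonal (i≢j ∘ sym)) (trans (offDiag-off H (i≢j ∘ sym)) (skew i≢j)) ⟩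
    0ℤ - H i j - - H i j
      ≡⟨ cancel (H i j) ⟩
    0ℤ ∎
    where
    open ≡-Reasoning
    cancel : ∀ h → 0ℤ - h - - h ≡ 0ℤ
    cancel = solve-∀

  sum-path : ∀ {a c : Fin n} → a ≢ c → sum (λ d → S c d * S d a) ≡ 0ℤ
  sum-path {a} {c} a≢c = begin
    sum (λ d → S c d * S d a)
      ≡⟨ sum-cong-≗ (λ d → trans (cong (λ s → S c d * s) (S-skew a d)) (sym (ℤP.neg-distribʳ-* (S c d) (S a d)))) ⟩
    sum (λ d → - (S c d * S a d)) ≡⟨ sum-neg (λ d → S c d * S a d) ⟩
    - sum (λ d → S c d * S a d)   ≡⟨ cong -_ (S-orthogonal (a≢c ∘ sym)) ⟩
    0ℤ                            ∎
    where open ≡-Reasoning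

  sum-avoiding-both : ∀ {a c : Fin n} → a ≢ c → sum (λ b → (1ℤ - δ a b) * (1ℤ - δ b c)) ≡ + n - + 2
  sum-avoiding-both {a} {c} a≢c = begin
    sum (λ b → (1ℤ - δ a b) * (1ℤ - δ b c))  ≡⟨ sum-avoid a (λ b → 1ℤ - δ b c) ⟩
    sum (λ b → 1ℤ - δ b c) - (1ℤ - δ a c)
      ≡⟨ cong₂ (λ x y → x - (1ℤ - y))
               (sum-cong-≗ λ b → trans (cong (λ x → 1ℤ - x) (δ-sym b c)) (sym (ℤP.*-identityʳ (1ℤ - δ c b))))
               (scalarI-off 1ℤ a≢c) ⟩
    sum (λ b → (1ℤ - δ c b) * 1ℤ) - (1ℤ - 0ℤ)  ≡⟨ cong (_- 1ℤ) (sum-avoid c (λ _ → 1ℤ)) ⟩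
    sum {n} (λ _ → 1ℤ) - 1ℤ - 1ℤ              ≡⟨ cong (λ s → s - 1ℤ - 1ℤ) (sum-const n 1ℤ) ⟩
    + n * 1ℤ - 1ℤ - 1ℤ                         ≡⟨ simplify (+ n) ⟩
    + n - + 2                                  ∎
    where
    open ≡-Reasoning
    simplify : ∀ m → m * 1ℤ - 1ℤ - 1ℤ ≡ m - + 2
    simplify = solve-∀

  sum-cycleTerm-opposite : ∀ {a c : Fin n} → a ≢ c → sum (λ b → sum (λ d → cycleTerm H a b c d)) ≡ - (+ n - + 2)
  sum-cycleTerm-opposite {a} {c} a≢c = begin
    sum (λ b → sum (λ d → cycleTerm H a b c d))
      ≡⟨ sum-cong-≗ (λ b → sum-cong-≗ λ d → split b d) ⟩
    sum (λ b → sum (λ d → u b * ((1ℤ - δ b d) * w d)))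
      ≡⟨ sum-cong-≗ (λ b → trans (sym (*-distribˡ-sum (u b) (λ d → (1ℤ - δ b d) * w d)))
                                 (cong (λ s → u b * s) (sum-avoid b w))) ⟩
    sum (λ b → u b * (sum w - w b))
      ≡⟨ sum-cong-≗ (λ b → trans (cong (λ s → u b * (s - w b)) (sum-path a≢c))
                                 (trans (negate (u b) (w b)) (cong -_ (closed-path b)))) ⟩
    sum (λ b → - ((1ℤ - δ a b) * (1ℤ - δ b c)))
      ≡⟨ trans (sum-neg (λ b → (1ℤ - δ a b) * (1ℤ - δ b c))) (cong -_ (sum-avoiding-both a≢c)) ⟩
    - (+ n - + 2) ∎
    where
    open ≡-Reasoning
    u w : Fin n → ℤ
    u b = S a b * S b c
    w d = S c d * S d a
    regroup : ∀ x₁ x₂ x₃ x₄ e → x₁ * x₂ * x₃ * x₄ * (1ℤ - 0ℤ) * (1ℤ - e) ≡ x₁ * x₂ * ((1ℤ - e) * (x₃ * x₄))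
    regroup = solve-∀
    split : ∀ b d → cycleTerm H a b c d ≡ u b * ((1ℤ - δ b d) * w d)
    split b d = trans (cong₂ (λ x y → S a b * S b c * S c d * S d a * x * y)
                             (trans (S-sq a c) (cong (λ x → 1ℤ - x) (scalarI-off 1ℤ a≢c))) (S-sq b d))
                      (regroup (S a b) (S b c) (S c d) (S d a) (δ b d))
    negate : ∀ x y → x * (0ℤ - y) ≡ - (x * y)
    negate = solve-∀
    closed-path : ∀ b → u b * w b ≡ (1ℤ - δ a b) * (1ℤ - δ b c)
    closed-path b = begin
      S a b * S b c * (S c b * S b a)       ≡⟨ cong₂ (λ x y → S a b * S b c * (x * y)) (S-skew b c) (S-skew a b) ⟩
      S a b * S b c * (- S b c * - S a b)   ≡⟨ squares (S a b) (S b c) ⟩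
      S a b * S a b * (S b c * S b c)       ≡⟨ cong₂ _*_ (S-sq a b) (S-sq b c) ⟩
      (1ℤ - δ a b) * (1ℤ - δ b c)           ∎
      where
      squares : ∀ x y → x * y * (- y * - x) ≡ x * x * (y * y)
      squares = solve-∀

  cycleSum-skewHadamard : cycleSum H ≡ - (+ n - + 2) * (+ n * (+ n - 1ℤ))
  cycleSum-skewHadamard = begin
    cycleSum H
      ≡⟨ sum-cong-≗ (λ a → ∑-comm (λ b c → sum (λ d → cycleTerm H a b c d))) ⟩
    sum (λ a → sum (λ c → sum (λ b → sum (λ d → cycleTerm H a b c d))))
      ≡⟨ sum-cong-≗ (λ a → sum-cong-≗ λ c → opposite a c (a Fin.≟ c)) ⟩
    sum (λ (a : Fin n) → sum (λ c → (1ℤ - δ a c) * m))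
      ≡⟨ sum-cong-≗ (λ a → trans (sum-avoid {n} a (λ _ → m)) (cong (_- m) (sum-const n m))) ⟩
    sum {n} (λ a → + n * m - m)
      ≡⟨ sum-const n (+ n * m - m) ⟩
    + n * (+ n * m - m)
      ≡⟨ factor (+ n) m ⟩
    m * (+ n * (+ n - 1ℤ)) ∎
    where
    open ≡-Reasoning
    m : ℤ
    m = - (+ n - + 2)
    opposite : ∀ a c → Dec (a ≡ c) → sum (λ b → sum (λ d → cycleTerm H a b c d)) ≡ (1ℤ - δ a c) * m
    opposite a .a (yes refl) = trans
      (sum-zero λ b → sum-zero λ d → VanishesOnDiagonals.ac (cycleTerm-vanishesOnDiagonals H) a b d)
      (sym (trans (cong (λ x → (1ℤ - x) * m) (scalarI-diag 1ℤ a)) (ℤP.*-zeroˡ m)))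
    opposite a c  (no a≢c)   = trans
      (sum-cycleTerm-opposite a≢c)
      (sym (trans (cong (λ x → (1ℤ - x) * m) (scalarI-off 1ℤ a≢c)) (ℤP.*-identityˡ m)))
    factor : ∀ N y → N * (N * y - y) ≡ y * (N * (N - 1ℤ))
    factor = solve-∀

  module PrincipalSubmatrix {q} (inc : IncreasingQuad q) = SkewType4 (principal4-skewType H-skew inc)

  cycleSum≡8? : (q : Quad n) → Dec (cycleSum (principal4 H q) ≡ + 8)
  cycleSum≡8? q = cycleSum (principal4 H q) ℤ.≟ + 8

  A-quads : List (Quad n)
  A-quads = filter cycleSum≡8? (increasingTuples 3 n)

  A-quads-unique : Unique A-quads
  A-quads-unique = UniqueP.filter⁺ cycleSum≡8? (increasingTuples-unique 3 n)

  ∈-A-quads⇔ : ∀ q → (q ∈ A-quads) ⇔ (IncreasingQuad q × SHEquiv (principal4 H q) A)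
  ∈-A-quads⇔ q = mk⇔ to from
    where
    to : q ∈ A-quads → IncreasingQuad q × SHEquiv (principal4 H q) A
    to q∈ = inc , Equivalence.to (PrincipalSubmatrix.cycleSum≡8⇔SHEquiv-A inc) (proj₂ increasing×cycleSum≡8)
      where
      increasing×cycleSum≡8 : q ∈ increasingTuples 3 n × cycleSum (principal4 H q) ≡ + 8
      increasing×cycleSum≡8 = ∈-filter⁻ cycleSum≡8? {xs = increasingTuples 3 n} q∈
      inc : IncreasingQuad q
      inc = Increasing⇒IncreasingQuad (∈-increasingTuples⁻ 3 n q (proj₁ increasing×cycleSum≡8))
    from : IncreasingQuad q × SHEquiv (principal4 H q) A → q ∈ A-quads
    from (inc , q∼A) = ∈-filter⁺ cycleSum≡8? (∈-increasingTuples⁺ 3 n q (IncreasingQuad⇒Increasing inc))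
                                             (Equivalence.from (PrincipalSubmatrix.cycleSum≡8⇔SHEquiv-A inc) q∼A)

  length-A-quads : + 32 * + length A-quads ≡ sumIncreasing 3 n (λ q → cycleSum (principal4 H q) + + 24)
  length-A-quads = begin
    + 32 * + length A-quads
      ≡⟨ cong (λ l → + 32 * l) (trans (length-filter≡sumList cycleSum≡8? (increasingTuples 3 n))
                                       (sumList-increasingTuples 3 n (indicator ∘ cycleSum≡8?))) ⟩
    + 32 * sumIncreasing 3 n (indicator ∘ cycleSum≡8?)
      ≡⟨ sumIncreasing-*ˡ 3 n (+ 32) (indicator ∘ cycleSum≡8?) ⟨
    sumIncreasing 3 n (λ q → + 32 * indicator (cycleSum≡8? q))
      ≡⟨ sumIncreasing-cong 3 n (λ q inc → PrincipalSubmatrix.cycleSum≡8-indicator (Increasing⇒IncreasingQuad inc)) ⟩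
    sumIncreasing 3 n (λ q → cycleSum (principal4 H q) + + 24) ∎
    where open ≡-Reasoning

lemma2p7 : (n : ℕ) → (H : Mat n) → IsSkewHadamard n H →
    Σ (List (Quad n)) λ L →
      Unique L ×
      (∀ q → (q ∈ L) ⇔ (IncreasingQuad q × SHEquiv (principal4 H q) A)) ×
      ((+ 32) * (+ length L) ≡ (+ n) * ((+ n - + 1) * ((+ n - + 2) * (+ n - + 4))))
lemma2p7 n H H-skewHadamard = A-quads , A-quads-unique , ∈-A-quads⇔ , (begin
  + 32 * + length A-quads
    ≡⟨ length-A-quads ⟩
  sumIncreasing 3 n (λ q → cycleSum (principal4 H q) + + 24)
    ≡⟨ sumIncreasing-+ 3 n (cycleSum ∘ principal4 H) (λ _ → + 24) ⟩
  sumIncreasing 3 n (cycleSum ∘ principal4 H) + sumIncreasing 3 n (λ _ → + 24)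
    ≡⟨ cong₂ _+_ (sym (cycleSum≡sum-principal4 H)) (sumIncreasing-*ˡ 3 n (+ 24) (λ _ → 1ℤ)) ⟩
  cycleSum H + + 24 * countIncreasing 3 n
    ≡⟨ cong₂ _+_ cycleSum-skewHadamard (countIncreasing-3 n) ⟩
  - (+ n - + 2) * (+ n * (+ n - 1ℤ)) + + n * ((+ n - 1ℤ) * ((+ n - + 2) * (+ n - + 3)))
    ≡⟨ simplify (+ n) ⟩
  + n * ((+ n - + 1) * ((+ n - + 2) * (+ n - + 4))) ∎)
  where
  open SkewHadamard H-skewHadamard
  open ≡-Reasoning
  simplify : ∀ m → - (m - + 2) * (m * (m - 1ℤ)) + m * ((m - 1ℤ) * ((m - + 2) * (m - + 3)))
                 ≡ m * ((m - + 1) * ((m - + 2) * (m - + 4)))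
  simplify = solve-∀
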